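{- Let $\Pi=(\mathcal{P},\mathcal{L},\mathcal{I})$ be a finite projective plane of order $q$, let $\theta$ be a polarity of $\Pi$, and let $G(\Pi,\theta)$ be the corresponding polarity graph. If $H$ is an induced subgraph of $G(\Pi,\theta)$ that contains no triangle (cycle of length three), then \[ |V(H)| \leq \frac{1}{2}(q^2+q+1) + \sqrt{q}\left(\frac{q^2+q+1}{q+1}\right). \]
   Context: A finite projective plane $\Pi=(\mathcal{P},\mathcal{L},\mathcal{I})$ of order $q$ consists of a set of points $\mathcal{P}$, a set of lines $\mathcal{L}$ and an incidence relation $\mathcal{I}$ such that any two distinct points are incident to exactly one common line, any two distinct lines are incident to exactly one common point, every line is incident to exactly $q+1$ points and every point to exactly $q+1$ lines (so $|\mathcal{P}|=q^2+q+1$). A polarity $\theta$ of $\Pi$ is a bijection of order two mapping $\mathcal{P}$ to $\mathcal{L}$ and $\mathcal{L}$ to $\mathcal{P}$ such that for every point $p$ and line $l$, $p\,\mathcal{I}\,l$ if and only if $\theta(l)\,\mathcal{I}\,\theta(p)$. The polarity graph $G(\Pi,\theta)$ is the simple graph with vertex set $\mathcal{P}$ in which two distinct vertices $p,p'$ are adjacent if and only if $p\,\mathcal{I}\,\theta(p')$. A point $p$ is an absolute point of $\theta$ if $p\,\mathcal{I}\,\theta(p)$. -}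

module Defs where

open import Data.Nat using (ℕ; suc; _+_; _*_; _∸_; _^_; _≤_)
open import Data.Fin using (Fin)
open import Data.Fin.Subset using (Subset; _∈_; ∣_∣)
open import Data.Bool using (Bool; true)
open import Data.Vec using (tabulate)
open import Data.Product using (Σ; _×_; ∃)
open import Relation.Binary.PropositionalEquality using (_≡_; _≢_)
open import Relation.Nullary using (¬_)

numPts : ℕ → ℕ
numPts q = q * q + q + 1

record ProjectivePlane (q : ℕ) : Set where
  field
    order≥2 : 2 ≤ q
    I : Fin (numPts q) → Fin (numPts q) → Bool   -- I p l : point p incident with line l
    pts-line : ∀ p p' → p ≢ p' →
      Σ (Fin (numPts q)) λ l → (I p l ≡ true) × (I p' l ≡ true) ×
        (∀ l' → I p l' ≡ true → I p' l' ≡ true → l' ≡ l)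
    lines-pt : ∀ l l' → l ≢ l' →
      Σ (Fin (numPts q)) λ p → (I p l ≡ true) × (I p l' ≡ true) ×
        (∀ p' → I p' l ≡ true → I p' l' ≡ true → p' ≡ p)
    line-size : ∀ l → ∣ tabulate (λ p → I p l) ∣ ≡ suc q
    point-deg : ∀ p → ∣ tabulate (λ l → I p l) ∣ ≡ suc q

record Polarity {q : ℕ} (Π : ProjectivePlane q) : Set where
  open ProjectivePlane Π
  field
    θp : Fin (numPts q) → Fin (numPts q)
    θl : Fin (numPts q) → Fin (numPts q)
    θlθp : ∀ p → θl (θp p) ≡ p
    θpθl : ∀ l → θp (θl l) ≡ l
    incidence : ∀ p l → I p l ≡ I (θl l) (θp p)

Adj : {q : ℕ} {Π : ProjectivePlane q} → Polarity Π → Fin (numPts q) → Fin (numPts q) → Set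
Adj {Π = Π} θ p p' = p ≢ p' × (ProjectivePlane.I Π p (Polarity.θp θ p') ≡ true)

TriangleFree : {q : ℕ} {Π : ProjectivePlane q} → Polarity Π → Subset (numPts q) → Set
TriangleFree θ S = ∀ x y z → x ∈ S → y ∈ S → z ∈ S →
  ¬ (Adj θ x y × Adj θ y z × Adj θ x z)

module Submission where

-- Let A be the matrix with A w v = 1 iff v lies on the polar
-- line θ(w).  A is symmetric with A² = qI + J, so on vectors of sum zero its
-- eigenvalues are ±√q.  In integer form: for T > 0 with T² ≥ 4qn² every
-- integer vector f satisfies the quadratic "spectral inequality"
--   T·(n⟨f,f⟩ − s²) + 2n·(n⟨f,Af⟩ − (q+1)s²) ≥ 0,   s = Σ f,
-- proved by centring f and expanding the square Σ(2n·Ah + T·h)² ≥ 0.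
--
-- Split the points into S' (non-absolute points of S),
-- X (absolute points) and the rest R.  Triangle-freeness gives, for w ∈ S',
-- |θ(w) ∩ S'| ≤ |θ(w) ∩ R| (double counting through the points θ(v) ∩ θ(w)),
-- hence 2|θ(w) ∩ S'| + |θ(w) ∩ X| ≤ q+1; an absolute point w has θ(w) ∩ X = {w}.
-- These bound ⟨f,Af⟩ for f = 4·1_S' + 1_X and f = 1_X.
--
-- If T = (q+1)(2(|S'|+|X|) − n) were positive with
-- T² ≥ 4qn², the two spectral inequalities would bound |X| from below and
-- from above incompatibly.  Since |S| ≤ |S'| + |X| this proves the theorem.

open import Defs

open import Data.Nat as ℕ using (ℕ; zero; suc)
import Data.Nat.Properties as ℕP
open import Data.Fin using (Fin; zero; suc) renaming (_≟_ to _≟ᶠ_)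
open import Data.Fin.Subset using (Subset; ∣_∣; _∈_)
open import Data.Bool using (Bool; true; false; _∧_; not)
open import Data.Bool.Properties using (∧-conicalˡ; ∧-conicalʳ)
open import Data.Vec using (Vec; []; _∷_; lookup; tabulate)
open import Data.Vec.Properties using (lookup∘tabulate; lookup⇒[]=)
open import Data.Integer.Properties
open import Data.Integer.Tactic.RingSolver using (solve-∀)
open import Data.Product using (Σ-syntax; _×_; _,_; proj₁; proj₂)
open import Data.Empty using (⊥; ⊥-elim)
open import Relation.Binary.PropositionalEquality
open import Relation.Nullary using (yes; no)
open import Relation.Nullary.Decidable using (⌊_⌋)
open import Algebra.Properties.Semiring.Sum +-*-semiring
  using (sum; sum-syntax; sum-cong-≗; ∑-distrib-+; ∑-comm; *-distribˡ-sum; *-distribʳ-sum; sum-replicate-zero)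

module _ where
  open import Data.Integer
    using (ℤ; +_; +[1+_]; -[1+_]; 0ℤ; 1ℤ; _+_; _*_; -_; _-_; _≤_; _<_; +≤+; +<+; nonNegative; nonNeg)

  -- Finite sums and inner products of integer vectors indexed by Fin k

  sum-const : ∀ {k} (c : ℤ) → ∑[ i < k ] c ≡ + k * c
  sum-const {zero} c = sym (*-zeroˡ c)
  sum-const {suc k} c = trans (cong (_+_ c) (sum-const {k} c)) (ring c (+ k))
    where
    ring : ∀ c k → c + k * c ≡ (1ℤ + k) * c
    ring = solve-∀

  sum-lin : ∀ {k} (a b : ℤ) (f g : Fin k → ℤ) →
    ∑[ i < k ] (a * f i + b * g i) ≡ a * sum f + b * sum g
  sum-lin a b f g = trans (∑-distrib-+ (λ i → a * f i) (λ i → b * g i))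
    (sym (cong₂ _+_ (*-distribˡ-sum a f) (*-distribˡ-sum b g)))

  sum-lin3 : ∀ {k} (a b c : ℤ) (f g h : Fin k → ℤ) →
    ∑[ i < k ] (a * f i + b * g i + c * h i) ≡ a * sum f + b * sum g + c * sum h
  sum-lin3 a b c f g h =
    trans (∑-distrib-+ (λ i → a * f i + b * g i) (λ i → c * h i))
          (cong₂ _+_ (sum-lin a b f g) (sym (*-distribˡ-sum c h)))

  sum-affine : ∀ {k} (c e : ℤ) (f : Fin k → ℤ) →
    ∑[ i < k ] (c * f i + e) ≡ c * sum f + + k * e
  sum-affine {k} c e f = trans (∑-distrib-+ (λ i → c * f i) (λ _ → e))
    (cong₂ _+_ (sym (*-distribˡ-sum c f)) (sum-const {k} e))

  sum-product : ∀ {k l} (g : Fin k → ℤ) (h : Fin l → ℤ) →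
    sum g * sum h ≡ ∑[ u < k ] ∑[ v < l ] (g u * h v)
  sum-product g h = trans (*-distribʳ-sum (sum h) g)
    (sum-cong-≗ (λ u → *-distribˡ-sum (g u) h))

  sum-mono : ∀ {k} {f g : Fin k → ℤ} → (∀ i → f i ≤ g i) → sum f ≤ sum g
  sum-mono {zero} _ = ≤-refl
  sum-mono {suc k} f≤g = +-mono-≤ (f≤g zero) (sum-mono (λ i → f≤g (suc i)))

  sum-nonneg : ∀ {k} {f : Fin k → ℤ} → (∀ i → 0ℤ ≤ f i) → 0ℤ ≤ sum f
  sum-nonneg {k} f≥0 = ≤-trans (≤-reflexive (sym (sum-replicate-zero k))) (sum-mono f≥0)

  sum-term : ∀ {k} {f : Fin k → ℤ} → (∀ i → 0ℤ ≤ f i) → ∀ j → f j ≤ sum f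
  sum-term {suc k} {f} f≥0 zero = i≤i+j (f zero) _ {{nonNegative (sum-nonneg (λ i → f≥0 (suc i)))}}
  sum-term {suc k} {f} f≥0 (suc j) =
    ≤-trans (sum-term (λ i → f≥0 (suc i)) j) (i≤j+i _ (f zero) {{nonNegative (f≥0 zero)}})

  ⟨_,_⟩ : ∀ {k} → (Fin k → ℤ) → (Fin k → ℤ) → ℤ
  ⟨_,_⟩ {k} f g = ∑[ i < k ] (f i * g i)

  inner-comm : ∀ {k} (f g : Fin k → ℤ) → ⟨ f , g ⟩ ≡ ⟨ g , f ⟩
  inner-comm f g = sum-cong-≗ (λ i → *-comm (f i) (g i))

  inner-congʳ : ∀ {k} (f : Fin k → ℤ) {g g' : Fin k → ℤ} → (∀ i → g i ≡ g' i) → ⟨ f , g ⟩ ≡ ⟨ f , g' ⟩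
  inner-congʳ f g≗g' = sum-cong-≗ (λ i → cong (f i *_) (g≗g' i))

  inner-affine : ∀ {k} (g f : Fin k → ℤ) (c e : ℤ) →
    ⟨ g , (λ i → c * f i + e) ⟩ ≡ c * ⟨ g , f ⟩ + e * sum g
  inner-affine g f c e = trans (sum-cong-≗ (λ i → ring (g i) (f i) c e)) (sum-lin c e _ g)
    where
    ring : ∀ g f c e → g * (c * f + e) ≡ c * (g * f) + e * g
    ring = solve-∀

  inner-square : ∀ {k} (a b : ℤ) (f g : Fin k → ℤ) →
    let u = λ i → a * f i + b * g i in
    ⟨ u , u ⟩ ≡ a * a * ⟨ f , f ⟩ + + 2 * a * b * ⟨ f , g ⟩ + b * b * ⟨ g , g ⟩
  inner-square a b f g =
    trans (sum-cong-≗ (λ i → ring a b (f i) (g i)))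
      (sum-lin3 (a * a) (+ 2 * a * b) (b * b) (λ i → f i * f i) (λ i → f i * g i) (λ i → g i * g i))
    where
    ring : ∀ a b x y → (a * x + b * y) * (a * x + b * y) ≡
      a * a * (x * x) + + 2 * a * b * (x * y) + b * b * (y * y)
    ring = solve-∀

  -- Indicators, Kronecker delta and cardinalities

  true≢false : true ≢ false
  true≢false ()

  not-true : ∀ {b} → not b ≡ true → b ≡ false
  not-true {false} _ = refl

  χ : Bool → ℤ
  χ true = 1ℤ
  χ false = 0ℤ

  χ-nonneg : ∀ b → 0ℤ ≤ χ b
  χ-nonneg true = +≤+ ℕ.z≤n
  χ-nonneg false = +≤+ ℕ.z≤n

  χ-∧ : ∀ a b → χ a * χ b ≡ χ (a ∧ b)
  χ-∧ true true = refl
  χ-∧ true false = refl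
  χ-∧ false b = refl

  χ-scale-≤ : ∀ b {d} → 0ℤ ≤ d → χ b * d ≤ d
  χ-scale-≤ true _ = ≤-reflexive (*-identityˡ _)
  χ-scale-≤ false d≥0 = d≥0

  χ-idem : ∀ b → χ b * χ b ≡ χ b
  χ-idem true = refl
  χ-idem false = refl

  χ-weight-≥ : ∀ b {Z} → (b ≡ true → 1ℤ ≤ Z) → χ b ≤ χ b * Z
  χ-weight-≥ true Z≥1 = ≤-trans (Z≥1 refl) (≤-reflexive (sym (*-identityˡ _)))
  χ-weight-≥ false _ = ≤-refl

  χ-weight-≤ : ∀ b {Z} → (b ≡ true → Z ≤ 1ℤ) → χ b * Z ≤ χ b
  χ-weight-≤ true Z≤1 = ≤-trans (≤-reflexive (*-identityˡ _)) (Z≤1 refl)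
  χ-weight-≤ false _ = ≤-refl

  δ : ∀ {k} → Fin k → Fin k → ℤ
  δ i j = χ ⌊ i ≟ᶠ j ⌋

  δ-self : ∀ {k} (i : Fin k) → δ i i ≡ 1ℤ
  δ-self i with i ≟ᶠ i
  ... | yes _ = refl
  ... | no i≢i = ⊥-elim (i≢i refl)

  δ-distinct : ∀ {k} {i j : Fin k} → i ≢ j → δ i j ≡ 0ℤ
  δ-distinct {i = i} {j} i≢j with i ≟ᶠ j
  ... | yes i≡j = ⊥-elim (i≢j i≡j)
  ... | no _ = refl

  δ-sym : ∀ {k} (i j : Fin k) → δ i j ≡ δ j i
  δ-sym i j with i ≟ᶠ j | j ≟ᶠ i
  ... | yes _ | yes _ = refl
  ... | no _ | no _ = refl
  ... | yes i≡j | no j≢i = ⊥-elim (j≢i (sym i≡j))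
  ... | no i≢j | yes j≡i = ⊥-elim (i≢j (sym j≡i))

  sum-δ : ∀ {k} (j : Fin k) (f : Fin k → ℤ) → ∑[ i < k ] (δ i j * f i) ≡ f j
  sum-δ {suc k} zero f = begin
    1ℤ * f zero + ∑[ i < k ] (0ℤ * f (suc i))
      ≡⟨ cong₂ _+_ (*-identityˡ (f zero)) (trans (sum-cong-≗ (λ i → *-zeroˡ (f (suc i)))) (sum-replicate-zero k)) ⟩
    f zero + 0ℤ
      ≡⟨ +-identityʳ (f zero) ⟩
    f zero                                     ∎
    where open ≡-Reasoning
  sum-δ {suc k} (suc j) f = begin
    0ℤ + ∑[ i < k ] (δ (suc i) (suc j) * f (suc i))   ≡⟨ +-identityˡ _ ⟩
    ∑[ i < k ] (δ (suc i) (suc j) * f (suc i))        ≡⟨ sum-cong-≗ (λ i → cong (_* f (suc i)) (δ-suc i j)) ⟩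
    ∑[ i < k ] (δ i j * f (suc i))                    ≡⟨ sum-δ j (λ i → f (suc i)) ⟩
    f (suc j)                                         ∎
    where
    open ≡-Reasoning
    δ-suc : ∀ {k} (i j : Fin k) → δ (suc i) (suc j) ≡ δ i j
    δ-suc i j with i ≟ᶠ j
    ... | yes _ = refl
    ... | no _ = refl

  card-sum : ∀ {k} (V : Vec Bool k) → + ∣ V ∣ ≡ ∑[ i < k ] χ (lookup V i)
  card-sum [] = refl
  card-sum (true ∷ V) = cong (_+_ 1ℤ) (card-sum V)
  card-sum (false ∷ V) = trans (card-sum V) (sym (+-identityˡ _))

  card-tabulate : ∀ {k} (g : Fin k → Bool) → + ∣ tabulate g ∣ ≡ ∑[ i < k ] χ (g i)
  card-tabulate g = trans (card-sum (tabulate g)) (sum-cong-≗ (λ i → cong χ (lookup∘tabulate g i)))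

  -- Sign bookkeeping in ℤ

  mul-nonneg : ∀ {a b} → 0ℤ ≤ a → 0ℤ ≤ b → 0ℤ ≤ a * b
  mul-nonneg {+ m} {+ k} _ _ = ≤-trans (+≤+ ℕ.z≤n) (≤-reflexive (pos-* m k))

  mul-pos : ∀ {a b} → 0ℤ < a → 0ℤ < b → 0ℤ < a * b
  mul-pos {+[1+ a ]} {+[1+ b ]} _ _ = +<+ (ℕ.s≤s ℕ.z≤n)
  mul-pos {+ zero} (+<+ ()) _
  mul-pos {+[1+ a ]} {+ zero} _ (+<+ ())

  sq-nonneg : ∀ a → 0ℤ ≤ a * a
  sq-nonneg (+ m) = mul-nonneg {+ m} {+ m} (+≤+ ℕ.z≤n) (+≤+ ℕ.z≤n)
  sq-nonneg -[1+ m ] = +≤+ ℕ.z≤n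

  sq-mono : ∀ {x y} → 0ℤ ≤ x → x ≤ y → x * x ≤ y * y
  sq-mono {x} {y} x≥0 x≤y = ≤-trans (*-monoˡ-≤-nonNeg x {{nonNegative x≥0}} x≤y)
    (*-monoʳ-≤-nonNeg y {{nonNegative (≤-trans x≥0 x≤y)}} x≤y)

  cancel-pos : ∀ {c x} → 0ℤ < c → 0ℤ ≤ c * x → 0ℤ ≤ x
  cancel-pos {+[1+ c ]} {+ x} _ _ = +≤+ ℕ.z≤n
  cancel-pos {+[1+ c ]} { -[1+ x ]} _ ()
  cancel-pos {+ zero} (+<+ ()) _

  pos-factorʳ : ∀ {a b} → 0ℤ ≤ a → 0ℤ < a * b → 0ℤ < b
  pos-factorʳ {+ a} {+[1+ b ]} _ _ = +<+ (ℕ.s≤s ℕ.z≤n)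
  pos-factorʳ {+ a} {+ zero} _ ab>0 = ⊥-elim (<-irrefl (sym (*-zeroʳ (+ a))) ab>0)
  pos-factorʳ {+ zero} { -[1+ b ]} _ (+<+ ())
  pos-factorʳ {+[1+ a ]} { -[1+ b ]} _ ()

  -- The spectral inequality and the arithmetic it forces

  -- T·(kQ − s²) + 2k·(kP − (q+1)s²) ≥ 0: what the eigenvalue bound says about a
  -- vector with sum s, ⟨f,f⟩ = Q and ⟨f,Af⟩ = P, when T/2k ≥ √q.
  SpectralIneq : (q k T s Q P : ℤ) → Set
  SpectralIneq q k T s Q P = 0ℤ ≤ T * (k * Q - s * s) + + 2 * k * (k * P - (1ℤ + q) * (s * s))

  SpectralIneq-mono : ∀ {q k T s Q P P'} → 0ℤ ≤ k → P ≤ P' →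
    SpectralIneq q k T s Q P → SpectralIneq q k T s Q P'
  SpectralIneq-mono {q} {k} {T} {s} {Q} {P} {P'} k≥0 P≤P' ineq = ≤-trans
    (+-mono-≤ ineq (mul-nonneg (mul-nonneg {+ 2 * k} (mul-nonneg {+ 2} (+≤+ ℕ.z≤n) k≥0) k≥0)
      (i≤j⇒0≤j-i P≤P')))
    (≤-reflexive (ring q k T s Q P P'))
    where
    ring : ∀ q k T s Q P P' →
      T * (k * Q - s * s) + + 2 * k * (k * P - (1ℤ + q) * (s * s)) + + 2 * k * k * (P' - P) ≡
      T * (k * Q - s * s) + + 2 * k * (k * P' - (1ℤ + q) * (s * s))
    ring = solve-∀

  -- Here a, N stand for |S'|, |X| and
  -- d = 2(a+N) − n is the excess over n/2.  The spectral inequality for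
  -- 4·1_S' + 1_X bounds N from below, the one for 1_X bounds N from above,
  -- and the two bounds are incompatible once T = (q+1)d satisfies T² ≥ 4qn².
  excess-contradiction : ∀ (q n a N : ℤ) → + 2 ≤ q → 0ℤ < n → 0ℤ ≤ N →
    let d = + 2 * (a + N) - n ; T = (1ℤ + q) * d in
    0ℤ < d → + 4 * q * (n * n) ≤ T * T →
    SpectralIneq q n T (+ 4 * a + N) (+ 16 * a + N) (+ 8 * (1ℤ + q) * a + N) →
    SpectralIneq q n T N N N → ⊥
  excess-contradiction q n a N q≥2 n>0 N≥0 d>0 T²≥4qn² ineq₁ ineq₂ =
    <-irrefl refl (<-≤-trans Y>0 (begin
      Y        ≡⟨ sym (+-identityˡ Y) ⟩
      0ℤ + Y   ≤⟨ +-monoˡ-≤ Y Z≥0 ⟩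
      Z + Y    ≡⟨ Z+Y≡0 ⟩
      0ℤ       ∎))
    where
    open ≤-Reasoning
    d T K A Y Z : ℤ
    d = + 2 * (a + N) - n
    T = (1ℤ + q) * d
    -- the lower bound reads N·A ≥ 4n(1+q)d, the upper bound N·K ≤ n(T+2n)
    K = (1ℤ + q) * (d + + 2 * n)
    A = n * (+ 8 * q + + 10) - + 3 * T
    -- eliminating N yields Z ≥ 0, while Z = −Y with Y visibly positive
    Z = (+ 16 * q + + 20) * n * n - + 7 * T * T - + 4 * n * T
    Y = + 7 * (T * T - + 4 * q * (n * n)) + (+ 12 * (q - + 2) + + 4) * (n * n) + + 4 * n * T

    q+1>0 : 0ℤ < 1ℤ + q
    q+1>0 = <-≤-trans (+<+ (ℕ.s≤s ℕ.z≤n)) (+-monoʳ-≤ 1ℤ (≤-trans (+≤+ ℕ.z≤n) q≥2))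

    T>0 : 0ℤ < T
    T>0 = mul-pos q+1>0 d>0

    K≥0 : 0ℤ ≤ K
    K≥0 = mul-nonneg (<⇒≤ q+1>0) (+-mono-≤ (<⇒≤ d>0) (mul-nonneg {+ 2} (+≤+ ℕ.z≤n) (<⇒≤ n>0)))

    lower-identity : ∀ q n a N →
      let d = + 2 * (a + N) - n ; T = (1ℤ + q) * d in
      T * (n * (+ 16 * a + N) - (+ 4 * a + N) * (+ 4 * a + N)) +
      + 2 * n * (n * (+ 8 * (1ℤ + q) * a + N) - (1ℤ + q) * ((+ 4 * a + N) * (+ 4 * a + N))) +
      (1ℤ + q) * (d + + 2 * n) * ((+ 2 * d - + 3 * N) * (+ 2 * d - + 3 * N)) ≡
      n * (N * (n * (+ 8 * q + + 10) - + 3 * T) - + 4 * n * (1ℤ + q) * d)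
    lower-identity = solve-∀

    many-absolute : 0ℤ ≤ N * A - + 4 * n * (1ℤ + q) * d
    many-absolute = cancel-pos n>0 (≤-trans (+-mono-≤ ineq₁ (mul-nonneg K≥0 (sq-nonneg (+ 2 * d - + 3 * N))))
      (≤-reflexive (lower-identity q n a N)))

    NA>0 : 0ℤ < N * A
    NA>0 = <-≤-trans (mul-pos (mul-pos (mul-pos {+ 4} (+<+ (ℕ.s≤s ℕ.z≤n)) n>0) q+1>0) d>0)
      (0≤i-j⇒j≤i many-absolute)

    A>0 : 0ℤ < A
    A>0 = pos-factorʳ N≥0 NA>0

    N>0 : 0ℤ < N
    N>0 = pos-factorʳ (<⇒≤ A>0) (<-≤-trans NA>0 (≤-reflexive (*-comm N A)))

    upper-identity : ∀ q n a N →
      let d = + 2 * (a + N) - n ; T = (1ℤ + q) * d in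
      T * (n * N - N * N) + + 2 * n * (n * N - (1ℤ + q) * (N * N)) ≡
      N * (n * (T + + 2 * n) - N * ((1ℤ + q) * (d + + 2 * n)))
    upper-identity = solve-∀

    few-absolute : 0ℤ ≤ n * (T + + 2 * n) - N * K
    few-absolute = cancel-pos N>0 (≤-trans ineq₂ (≤-reflexive (upper-identity q n a N)))

    elimination-identity : ∀ q n a N →
      let d = + 2 * (a + N) - n ; T = (1ℤ + q) * d
          K = (1ℤ + q) * (d + + 2 * n) ; A = n * (+ 8 * q + + 10) - + 3 * T in
      K * (N * A - + 4 * n * (1ℤ + q) * d) + A * (n * (T + + 2 * n) - N * K) ≡
      n * ((+ 16 * q + + 20) * n * n - + 7 * T * T - + 4 * n * T)
    elimination-identity = solve-∀

    Z≥0 : 0ℤ ≤ Z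
    Z≥0 = cancel-pos n>0 (≤-trans (+-mono-≤ (mul-nonneg K≥0 many-absolute) (mul-nonneg (<⇒≤ A>0) few-absolute))
      (≤-reflexive (elimination-identity q n a N)))

    Z+Y≡0 : Z + Y ≡ 0ℤ
    Z+Y≡0 = ring q n T
      where
      ring : ∀ q n T → (+ 16 * q + + 20) * n * n - + 7 * T * T - + 4 * n * T +
        (+ 7 * (T * T - + 4 * q * (n * n)) + (+ 12 * (q - + 2) + + 4) * (n * n) + + 4 * n * T) ≡ 0ℤ
      ring = solve-∀

    Y>0 : 0ℤ < Y
    Y>0 = +-mono-≤-< (+-mono-≤ (mul-nonneg {+ 7} (+≤+ ℕ.z≤n) (i≤j⇒0≤j-i T²≥4qn²))
                              (mul-nonneg coefficient≥0 (sq-nonneg n)))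
                     (mul-pos (mul-pos {+ 4} (+<+ (ℕ.s≤s ℕ.z≤n)) n>0) T>0)
      where
      coefficient≥0 : 0ℤ ≤ + 12 * (q - + 2) + + 4
      coefficient≥0 = +-mono-≤ (mul-nonneg {+ 12} (+≤+ ℕ.z≤n) (i≤j⇒0≤j-i q≥2)) (+≤+ {0} {4} ℕ.z≤n)

  -- Symmetric matrices with A² = qI + J satisfy the spectral inequality

  module SpectralBound {k : ℕ} (q : ℕ) (A : Fin k → Fin k → ℤ)
    (A-sym : ∀ u v → A u v ≡ A v u)
    (A-rowSum : ∀ w → ∑[ v < k ] A w v ≡ 1ℤ + + q)
    (A-square : ∀ u v → ∑[ w < k ] (A w u * A w v) ≡ 1ℤ + + q * δ u v) where

    act : (Fin k → ℤ) → Fin k → ℤ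
    act f w = ∑[ v < k ] (A w v * f v)

    act-affine : ∀ (c e : ℤ) (f : Fin k → ℤ) w →
      act (λ v → c * f v + e) w ≡ c * act f w + e * (1ℤ + + q)
    act-affine c e f w = trans (inner-affine (A w) f c e) (cong (λ r → c * act f w + e * r) (A-rowSum w))

    act-selfadjoint : ∀ (g h : Fin k → ℤ) → ⟨ g , act h ⟩ ≡ ⟨ h , act g ⟩
    act-selfadjoint g h = begin
      ∑[ w < k ] (g w * act h w)                    ≡⟨ sum-cong-≗ (λ w → *-distribˡ-sum (g w) (λ v → A w v * h v)) ⟩
      ∑[ w < k ] ∑[ v < k ] (g w * (A w v * h v))   ≡⟨ ∑-comm (λ w v → g w * (A w v * h v)) ⟩
      ∑[ v < k ] ∑[ w < k ] (g w * (A w v * h v))   ≡⟨ sum-cong-≗ (λ v → sum-cong-≗ (λ w → reorder v w)) ⟩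
      ∑[ v < k ] ∑[ w < k ] (h v * (A v w * g w))   ≡⟨ sum-cong-≗ (λ v → sym (*-distribˡ-sum (h v) (λ w → A v w * g w))) ⟩
      ∑[ v < k ] (h v * act g v)                    ∎
      where
      open ≡-Reasoning
      ring : ∀ g a h → g * (a * h) ≡ h * (a * g)
      ring = solve-∀
      reorder : ∀ v w → g w * (A w v * h v) ≡ h v * (A v w * g w)
      reorder v w = trans (cong (λ a → g w * (a * h v)) (A-sym w v)) (ring (g w) (A v w) (h v))

    sum-act : ∀ (f : Fin k → ℤ) → sum (act f) ≡ (1ℤ + + q) * sum f
    sum-act f = begin
      sum (act f)                     ≡⟨ sum-cong-≗ (λ w → sym (*-identityˡ (act f w))) ⟩
      ⟨ (λ _ → 1ℤ) , act f ⟩          ≡⟨ act-selfadjoint (λ _ → 1ℤ) f ⟩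
      ⟨ f , act (λ _ → 1ℤ) ⟩          ≡⟨ inner-congʳ f (λ w → trans (sum-cong-≗ (λ v → *-identityʳ (A w v))) (A-rowSum w)) ⟩
      ∑[ v < k ] (f v * (1ℤ + + q))   ≡⟨ sym (*-distribʳ-sum (1ℤ + + q) f) ⟩
      sum f * (1ℤ + + q)              ≡⟨ *-comm (sum f) (1ℤ + + q) ⟩
      (1ℤ + + q) * sum f              ∎
      where open ≡-Reasoning

    act-norm : ∀ (f : Fin k → ℤ) → ⟨ act f , act f ⟩ ≡ + q * ⟨ f , f ⟩ + sum f * sum f
    act-norm f = begin
      ∑[ w < k ] (act f w * act f w)
        ≡⟨ sum-cong-≗ (λ w → sum-product (λ u → A w u * f u) (λ v → A w v * f v)) ⟩
      ∑[ w < k ] ∑[ u < k ] ∑[ v < k ] ((A w u * f u) * (A w v * f v))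
        ≡⟨ ∑-comm (λ w u → ∑[ v < k ] ((A w u * f u) * (A w v * f v))) ⟩
      ∑[ u < k ] ∑[ w < k ] ∑[ v < k ] ((A w u * f u) * (A w v * f v))
        ≡⟨ sum-cong-≗ (λ u → ∑-comm (λ w v → (A w u * f u) * (A w v * f v))) ⟩
      ∑[ u < k ] ∑[ v < k ] ∑[ w < k ] ((A w u * f u) * (A w v * f v))
        ≡⟨ sum-cong-≗ (λ u → sum-cong-≗ (λ v → pair-sum u v)) ⟩
      ∑[ u < k ] ∑[ v < k ] (f u * f v + + q * f u * (δ v u * f v))
        ≡⟨ sum-cong-≗ (λ u → trans (sum-lin (f u) (+ q * f u) f (λ v → δ v u * f v))
                                    (cong (λ r → f u * sum f + + q * f u * r) (sum-δ u f))) ⟩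
      ∑[ u < k ] (f u * sum f + + q * f u * f u)
        ≡⟨ sum-cong-≗ (λ u → ring₂ (f u) (sum f) (+ q)) ⟩
      ∑[ u < k ] (sum f * f u + + q * (f u * f u))
        ≡⟨ sum-lin (sum f) (+ q) f (λ u → f u * f u) ⟩
      sum f * sum f + + q * ⟨ f , f ⟩
        ≡⟨ +-comm (sum f * sum f) (+ q * ⟨ f , f ⟩) ⟩
      + q * ⟨ f , f ⟩ + sum f * sum f ∎
      where
      open ≡-Reasoning
      ring₁ : ∀ a x b y → (a * x) * (b * y) ≡ x * y * (a * b)
      ring₁ = solve-∀
      ring₂ : ∀ x s q → x * s + q * x * x ≡ s * x + q * (x * x)
      ring₂ = solve-∀
      ring₃ : ∀ x y q d → x * y * (1ℤ + q * d) ≡ x * y + q * x * (d * y)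
      ring₃ = solve-∀
      pair-sum : ∀ u v → ∑[ w < k ] ((A w u * f u) * (A w v * f v)) ≡ f u * f v + + q * f u * (δ v u * f v)
      pair-sum u v = begin
        ∑[ w < k ] ((A w u * f u) * (A w v * f v))  ≡⟨ sum-cong-≗ (λ w → ring₁ (A w u) (f u) (A w v) (f v)) ⟩
        ∑[ w < k ] (f u * f v * (A w u * A w v))    ≡⟨ sym (*-distribˡ-sum (f u * f v) (λ w → A w u * A w v)) ⟩
        f u * f v * ∑[ w < k ] (A w u * A w v)      ≡⟨ cong (f u * f v *_) (A-square u v) ⟩
        f u * f v * (1ℤ + + q * δ u v)              ≡⟨ ring₃ (f u) (f v) (+ q) (δ u v) ⟩
        f u * f v + + q * f u * (δ u v * f v)       ≡⟨ cong (λ d → f u * f v + + q * f u * (d * f v)) (δ-sym u v) ⟩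
        f u * f v + + q * f u * (δ v u * f v)       ∎

    -- On vectors of sum zero the eigenvalues are ±√q, so ⟨h,Ah⟩ ≥ −√q‖h‖²;
    -- here with √q replaced by any rational T/2m ≥ √q.  The proof expands
    -- ‖2m·Ah + T·h‖² ≥ 0 using ‖Ah‖² = q‖h‖².
    mean-zero-bound : ∀ (h : Fin k → ℤ) (m T : ℤ) → sum h ≡ 0ℤ → 0ℤ < T →
      + 4 * + q * (m * m) ≤ T * T → 0ℤ ≤ T * ⟨ h , h ⟩ + + 2 * m * ⟨ h , act h ⟩
    mean-zero-bound h m T Σh≡0 T>0 T²≥4qm² = cancel-pos (mul-pos {+ 2} (+<+ (ℕ.s≤s ℕ.z≤n)) T>0) (begin
      0ℤ
        ≤⟨ +-mono-≤ (sum-nonneg (λ i → sq-nonneg (u i))) (mul-nonneg (i≤j⇒0≤j-i T²≥4qm²) (sum-nonneg (λ i → sq-nonneg (h i)))) ⟩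
      ⟨ u , u ⟩ + (T * T - + 4 * + q * (m * m)) * ⟨ h , h ⟩
        ≡⟨ cong (_+ (T * T - + 4 * + q * (m * m)) * ⟨ h , h ⟩) (inner-square (+ 2 * m) T (act h) h) ⟩
      + 2 * m * (+ 2 * m) * ⟨ act h , act h ⟩ + + 2 * (+ 2 * m) * T * ⟨ act h , h ⟩ + T * T * ⟨ h , h ⟩
        + (T * T - + 4 * + q * (m * m)) * ⟨ h , h ⟩
        ≡⟨ cong₂ (λ a b → + 2 * m * (+ 2 * m) * a + + 2 * (+ 2 * m) * T * b + T * T * ⟨ h , h ⟩
                            + (T * T - + 4 * + q * (m * m)) * ⟨ h , h ⟩)
                 norm-Ah (inner-comm (act h) h) ⟩
      + 2 * m * (+ 2 * m) * (+ q * ⟨ h , h ⟩) + + 2 * (+ 2 * m) * T * ⟨ h , act h ⟩ + T * T * ⟨ h , h ⟩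
        + (T * T - + 4 * + q * (m * m)) * ⟨ h , h ⟩
        ≡⟨ ring m T (+ q) ⟨ h , h ⟩ ⟨ h , act h ⟩ ⟩
      + 2 * T * (T * ⟨ h , h ⟩ + + 2 * m * ⟨ h , act h ⟩) ∎)
      where
      open ≤-Reasoning
      u : Fin k → ℤ
      u i = + 2 * m * act h i + T * h i
      norm-Ah : ⟨ act h , act h ⟩ ≡ + q * ⟨ h , h ⟩
      norm-Ah = trans (act-norm h) (trans (cong (λ s → + q * ⟨ h , h ⟩ + s * s) Σh≡0) (+-identityʳ _))
      ring : ∀ m T q N P → + 2 * m * (+ 2 * m) * (q * N) + + 2 * (+ 2 * m) * T * P + T * T * N
        + (T * T - + 4 * q * (m * m)) * N ≡ + 2 * T * (T * N + + 2 * m * P)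
      ring = solve-∀

    -- Centring f at its mean gives the spectral inequality for f itself.
    spectral-bound : ∀ (f : Fin k → ℤ) (T : ℤ) → 0ℤ < + k → 0ℤ < T →
      + 4 * + q * (+ k * + k) ≤ T * T → SpectralIneq (+ q) (+ k) T (sum f) ⟨ f , f ⟩ ⟨ f , act f ⟩
    spectral-bound f T k>0 T>0 T²≥4qk² = cancel-pos k>0 scaled
      where
      s : ℤ
      s = sum f
      h : Fin k → ℤ
      h v = + k * f v - s
      Σh≡0 : sum h ≡ 0ℤ
      Σh≡0 = trans (sum-affine (+ k) (- s) f) (ring₀ (+ k) s)
        where
        ring₀ : ∀ k s → k * s + k * - s ≡ 0ℤ
        ring₀ = solve-∀
      -- h is orthogonal to constants, so pairing with h ignores additive constants
      pair-h : ∀ (g : Fin k → ℤ) (c e : ℤ) → ⟨ h , (λ i → c * g i + e) ⟩ ≡ c * ⟨ g , h ⟩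
      pair-h g c e = trans (inner-affine h g c e)
        (trans (cong₂ (λ a b → c * a + e * b) (inner-comm h g) Σh≡0)
               (trans (cong (_+_ (c * ⟨ g , h ⟩)) (*-zeroʳ e)) (+-identityʳ _)))
      norm-h : ⟨ h , h ⟩ ≡ + k * (+ k * ⟨ f , f ⟩ - s * s)
      norm-h = trans (pair-h f (+ k) (- s))
        (cong (+ k *_) (trans (inner-affine f f (+ k) (- s)) (ring₁ (+ k) ⟨ f , f ⟩ s)))
        where
        ring₁ : ∀ k Q s → k * Q + - s * s ≡ k * Q - s * s
        ring₁ = solve-∀
      energy-h : ⟨ h , act h ⟩ ≡ + k * (+ k * ⟨ f , act f ⟩ - (1ℤ + + q) * (s * s))
      energy-h = begin
        ⟨ h , act h ⟩
          ≡⟨ inner-congʳ h (act-affine (+ k) (- s) f) ⟩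
        ⟨ h , (λ w → + k * act f w + - s * (1ℤ + + q)) ⟩
          ≡⟨ pair-h (act f) (+ k) (- s * (1ℤ + + q)) ⟩
        + k * ⟨ act f , h ⟩
          ≡⟨ cong (+ k *_) (inner-affine (act f) f (+ k) (- s)) ⟩
        + k * (+ k * ⟨ act f , f ⟩ + - s * sum (act f))
          ≡⟨ cong₂ (λ a b → + k * (+ k * a + - s * b)) (inner-comm (act f) f) (sum-act f) ⟩
        + k * (+ k * ⟨ f , act f ⟩ + - s * ((1ℤ + + q) * s))
          ≡⟨ cong (+ k *_) (ring₂ (+ k) ⟨ f , act f ⟩ s (1ℤ + + q)) ⟩
        + k * (+ k * ⟨ f , act f ⟩ - (1ℤ + + q) * (s * s)) ∎
        where
        open ≡-Reasoning
        ring₂ : ∀ k P s c → k * P + - s * (c * s) ≡ k * P - c * (s * s)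
        ring₂ = solve-∀
      ring : ∀ q k T s Q P → T * (k * (k * Q - s * s)) + + 2 * k * (k * (k * P - (1ℤ + q) * (s * s))) ≡
        k * (T * (k * Q - s * s) + + 2 * k * (k * P - (1ℤ + q) * (s * s)))
      ring = solve-∀
      scaled : 0ℤ ≤ + k * (T * (+ k * ⟨ f , f ⟩ - s * s) + + 2 * + k * (+ k * ⟨ f , act f ⟩ - (1ℤ + + q) * (s * s)))
      scaled = begin
        0ℤ
          ≤⟨ mean-zero-bound h (+ k) T Σh≡0 T>0 T²≥4qk² ⟩
        T * ⟨ h , h ⟩ + + 2 * + k * ⟨ h , act h ⟩
          ≡⟨ cong₂ (λ a b → T * a + + 2 * + k * b) norm-h energy-h ⟩
        T * (+ k * (+ k * ⟨ f , f ⟩ - s * s)) + + 2 * + k * (+ k * (+ k * ⟨ f , act f ⟩ - (1ℤ + + q) * (s * s)))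
          ≡⟨ ring (+ q) (+ k) T s ⟨ f , f ⟩ ⟨ f , act f ⟩ ⟩
        + k * (T * (+ k * ⟨ f , f ⟩ - s * s) + + 2 * + k * (+ k * ⟨ f , act f ⟩ - (1ℤ + + q) * (s * s))) ∎
        where open ≤-Reasoning

  -- The polarity graph

  module PolarityGraph {q : ℕ} (Π : ProjectivePlane q) (θ : Polarity Π) where
    open ProjectivePlane Π
    open Polarity θ

    n : ℕ
    n = numPts q

    Point : Set
    Point = Fin n

    polar-sym : ∀ v w → I v (θp w) ≡ I w (θp v)
    polar-sym v w = trans (incidence v (θp w)) (cong (λ x → I x (θp v)) (θlθp w))

    θp-injective : ∀ {v w} → θp v ≡ θp w → v ≡ w
    θp-injective {v} {w} eq = trans (sym (θlθp v)) (trans (cong θl eq) (θlθp w))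

    -- Adjacency matrix of G(Π,θ) with a loop at every absolute point.
    A : Point → Point → ℤ
    A w v = χ (I v (θp w))

    A-sym : ∀ u v → A u v ≡ A v u
    A-sym u v = cong χ (polar-sym v u)

    points-on-line : ∀ l → ∑[ v < n ] χ (I v l) ≡ 1ℤ + + q
    points-on-line l = trans (sym (card-tabulate (λ p → I p l))) (cong +_ (line-size l))

    lines-meet : ∀ l l' → l ≢ l' → Σ[ p ∈ Point ] (∀ v → χ (I v l) * χ (I v l') ≡ δ v p)
    lines-meet l l' l≢l' with lines-pt l l' l≢l'
    ... | p , p∈l , p∈l' , unique = p , indicator
      where
      indicator : ∀ v → χ (I v l) * χ (I v l') ≡ δ v p
      indicator v with I v l in v∈l | I v l' in v∈l'
      ... | true | true = sym (δ-self' (unique v v∈l v∈l'))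
        where
        δ-self' : v ≡ p → δ v p ≡ 1ℤ
        δ-self' refl = δ-self v
      ... | false | _ = sym (δ-distinct λ { refl → true≢false (trans (sym p∈l) v∈l) })
      ... | true | false = sym (δ-distinct λ { refl → true≢false (trans (sym p∈l') v∈l') })

    -- Two polars θ(u), θ(v) share q+1 points if u = v and one point otherwise.
    A-square : ∀ u v → ∑[ w < n ] (A w u * A w v) ≡ 1ℤ + + q * δ u v
    A-square u v with u ≟ᶠ v
    ... | yes refl = begin
      ∑[ w < n ] (A w u * A w u)       ≡⟨ sum-cong-≗ (λ w → trans (cong₂ _*_ (A-sym w u) (A-sym w u)) (χ-idem (I w (θp u)))) ⟩
      ∑[ w < n ] χ (I w (θp u))        ≡⟨ points-on-line (θp u) ⟩
      1ℤ + + q                         ≡⟨ cong (_+_ 1ℤ) (sym (*-identityʳ (+ q))) ⟩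
      1ℤ + + q * 1ℤ                    ∎
      where open ≡-Reasoning
    ... | no u≢v with lines-meet (θp u) (θp v) (λ eq → u≢v (θp-injective eq))
    ...   | p , meet = begin
      ∑[ w < n ] (A w u * A w v)       ≡⟨ sum-cong-≗ (λ w → trans (cong₂ _*_ (A-sym w u) (A-sym w v)) (trans (meet w) (sym (*-identityʳ (δ w p))))) ⟩
      ∑[ w < n ] (δ w p * 1ℤ)          ≡⟨ sum-δ p (λ _ → 1ℤ) ⟩
      1ℤ                               ≡⟨ cong (_+_ 1ℤ) (sym (*-zeroʳ (+ q))) ⟩
      1ℤ + + q * 0ℤ                    ∎
      where open ≡-Reasoning

    open SpectralBound q A A-sym (λ w → points-on-line (θp w)) A-square public

  -- Triangle-free vertex sets

  module TriangleFreeSet {q : ℕ} (Π : ProjectivePlane q) (θ : Polarity Π)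
    (S : Subset (numPts q)) (triangle-free : TriangleFree θ S) where
    open ProjectivePlane Π
    open Polarity θ
    open PolarityGraph Π θ

    inS absolute inS' inR : Point → Bool
    inS v = lookup S v
    absolute v = I v (θp v)
    inS' v = inS v ∧ not (absolute v)
    inR v = not (inS v) ∧ not (absolute v)

    χS' χX χR : Point → ℤ
    χS' v = χ (inS' v)
    χX v = χ (absolute v)
    χR v = χ (inR v)

    partition : ∀ v → χS' v + χX v + χR v ≡ 1ℤ
    partition v with inS v | absolute v
    ... | true | true = refl
    ... | true | false = refl
    ... | false | true = refl
    ... | false | false = refl

    x z t : Point → ℤ
    x = act χS'
    z = act χX
    t = act χR

    polar-split : ∀ w → x w + z w + t w ≡ 1ℤ + + q
    polar-split w = begin
      x w + z w + t w
        ≡⟨ ring₁ (x w) (z w) (t w) ⟩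
      1ℤ * x w + 1ℤ * z w + 1ℤ * t w
        ≡⟨ sym (sum-lin3 1ℤ 1ℤ 1ℤ (λ v → A w v * χS' v) (λ v → A w v * χX v) (λ v → A w v * χR v)) ⟩
      ∑[ v < n ] (1ℤ * (A w v * χS' v) + 1ℤ * (A w v * χX v) + 1ℤ * (A w v * χR v))
        ≡⟨ sum-cong-≗ (λ v → trans (ring₂ (A w v) (χS' v) (χX v) (χR v)) (trans (cong (A w v *_) (partition v)) (*-identityʳ (A w v)))) ⟩
      ∑[ v < n ] A w v
        ≡⟨ points-on-line (θp w) ⟩
      1ℤ + + q ∎
      where
      open ≡-Reasoning
      ring₁ : ∀ a b c → a + b + c ≡ 1ℤ * a + 1ℤ * b + 1ℤ * c
      ring₁ = solve-∀
      ring₂ : ∀ a s x r → 1ℤ * (a * s) + 1ℤ * (a * x) + 1ℤ * (a * r) ≡ a * (s + x + r)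
      ring₂ = solve-∀

    tangent : ∀ w → absolute w ≡ true → ∀ v → A w v * χX v ≡ δ v w
    tangent w w-abs v with v ≟ᶠ w
    ... | yes refl = cong (λ b → χ b * χ b) w-abs
    ... | no v≢w with I v (θp w) in v∈θw | absolute v in v-abs
    ...   | false | _ = refl
    ...   | true | false = refl
    ...   | true | true with pts-line v w v≢w
    ...     | l , _ , _ , unique =
      ⊥-elim (v≢w (θp-injective (trans (unique (θp v) v-abs (trans (polar-sym w v) v∈θw))
                                       (sym (unique (θp w) v∈θw w-abs)))))

    tangent-count : ∀ w → absolute w ≡ true → z w ≡ 1ℤ
    tangent-count w w-abs =
      trans (sum-cong-≗ (λ v → trans (tangent w w-abs v) (sym (*-identityʳ (δ v w))))) (sum-δ w (λ _ → 1ℤ))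

    commonR : Point → Point → Point → ℤ
    commonR w v u = A w u * χR u * A v u

    ∈S : ∀ {v} → inS v ≡ true → v ∈ S
    ∈S {v} v∈S = lookup⇒[]= v S v∈S

    -- An S'-neighbour v of a non-absolute w ∈ S meets w's polar in a point of
    -- R: the point θ(v) ∩ θ(w) is not in S (no triangle) and not absolute.
    R-witness : ∀ w → inS w ≡ true → absolute w ≡ false → ∀ v →
      A w v * χS' v ≤ A w v * χS' v * ∑[ u < n ] commonR w v u
    R-witness w w∈S w-nabs v = begin
      A w v * χS' v                                      ≡⟨ χ-∧ (I v (θp w)) (inS' v) ⟩
      χ (I v (θp w) ∧ inS' v)                            ≤⟨ χ-weight-≥ (I v (θp w) ∧ inS' v) witness ⟩
      χ (I v (θp w) ∧ inS' v) * ∑[ u < n ] commonR w v u ≡⟨ cong (_* ∑[ u < n ] commonR w v u) (sym (χ-∧ (I v (θp w)) (inS' v))) ⟩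
      A w v * χS' v * ∑[ u < n ] commonR w v u           ∎
      where
      open ≤-Reasoning
      witness : I v (θp w) ∧ inS' v ≡ true → 1ℤ ≤ ∑[ u < n ] commonR w v u
      witness hyp = ≤-trans (≤-reflexive (sym u₀-counted))
        (sum-term (λ u → mul-nonneg (mul-nonneg (χ-nonneg (I u (θp w))) (χ-nonneg (inR u))) (χ-nonneg (I u (θp v)))) u₀)
        where
        v∈θw : I v (θp w) ≡ true
        v∈θw = ∧-conicalˡ (I v (θp w)) (inS' v) hyp
        v∈S : inS v ≡ true
        v∈S = ∧-conicalˡ (inS v) (not (absolute v)) (∧-conicalʳ (I v (θp w)) (inS' v) hyp)
        v-nabs : absolute v ≡ false
        v-nabs = not-true (∧-conicalʳ (inS v) (not (absolute v)) (∧-conicalʳ (I v (θp w)) (inS' v) hyp))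
        θv≢θw : θp v ≢ θp w
        θv≢θw eq = true≢false (trans (sym (subst (λ y → I y (θp w) ≡ true) (θp-injective eq) v∈θw)) w-nabs)
        meet : Σ[ u ∈ Point ] (I u (θp v) ≡ true × I u (θp w) ≡ true ×
                               (∀ u' → I u' (θp v) ≡ true → I u' (θp w) ≡ true → u' ≡ u))
        meet = lines-pt (θp v) (θp w) θv≢θw
        u₀ : Point
        u₀ = proj₁ meet
        u₀∈θv : I u₀ (θp v) ≡ true
        u₀∈θv = proj₁ (proj₂ meet)
        u₀∈θw : I u₀ (θp w) ≡ true
        u₀∈θw = proj₁ (proj₂ (proj₂ meet))
        u₀≢v : u₀ ≢ v
        u₀≢v eq = true≢false (trans (sym (subst (λ y → I y (θp v) ≡ true) eq u₀∈θv)) v-nabs)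
        w≢v : w ≢ v
        w≢v refl = true≢false (trans (sym v∈θw) w-nabs)
        w≢u₀ : w ≢ u₀
        w≢u₀ eq = true≢false (trans (sym (subst (λ y → I y (θp w) ≡ true) (sym eq) u₀∈θw)) w-nabs)
        u₀∉S : inS u₀ ≡ false
        u₀∉S with inS u₀ in u₀∈S
        ... | false = refl
        ... | true = ⊥-elim (triangle-free w v u₀ (∈S w∈S) (∈S v∈S) (∈S u₀∈S)
          ((w≢v , trans (polar-sym w v) v∈θw) ,
           ((λ eq → u₀≢v (sym eq)) , trans (polar-sym v u₀) u₀∈θv) ,
           (w≢u₀ , trans (polar-sym w u₀) u₀∈θw)))
        -- an absolute u₀ would have θ(u₀) through v and w, forcing θ(u₀) = θ(w)
        u₀-nabs : absolute u₀ ≡ false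
        u₀-nabs with absolute u₀ in u₀-abs
        ... | false = refl
        ... | true with pts-line u₀ v u₀≢v
        ...   | l , _ , _ , unique = ⊥-elim (w≢u₀ (θp-injective
          (trans (unique (θp w) u₀∈θw v∈θw) (sym (unique (θp u₀) u₀-abs (trans (polar-sym v u₀) u₀∈θv))))))
        u₀-counted : commonR w v u₀ ≡ 1ℤ
        u₀-counted rewrite u₀∈θw | u₀∈θv | u₀∉S | u₀-nabs = refl

    -- A point u ∈ R on θ(w), w ∈ S, is on the polar of at most one S'-neighbour
    -- of w, namely the point θ(w) ∩ θ(u).
    S'-unique : ∀ w → inS w ≡ true → ∀ u → I u (θp w) ∧ inR u ≡ true →
      ∑[ v < n ] (A w v * χS' v * A v u) ≤ 1ℤ
    S'-unique w w∈S u hyp = begin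
      ∑[ v < n ] (A w v * χS' v * A v u)   ≤⟨ sum-mono bound ⟩
      ∑[ v < n ] (δ v p * 1ℤ)             ≡⟨ sum-δ p (λ _ → 1ℤ) ⟩
      1ℤ                                  ∎
      where
      open ≤-Reasoning
      u∉S : inS u ≡ false
      u∉S = not-true (∧-conicalˡ (not (inS u)) (not (absolute u)) (∧-conicalʳ (I u (θp w)) (inR u) hyp))
      θw≢θu : θp w ≢ θp u
      θw≢θu eq = true≢false (trans (sym w∈S) (trans (cong inS (θp-injective eq)) u∉S))
      meet : Σ[ p ∈ Point ] (∀ v → χ (I v (θp w)) * χ (I v (θp u)) ≡ δ v p)
      meet = lines-meet (θp w) (θp u) θw≢θu
      p : Point
      p = proj₁ meet
      ring : ∀ a b c → a * b * c ≡ b * (a * c)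
      ring = solve-∀
      bound : ∀ v → A w v * χS' v * A v u ≤ δ v p * 1ℤ
      bound v = begin
        A w v * χS' v * A v u               ≡⟨ ring (A w v) (χS' v) (A v u) ⟩
        χS' v * (A w v * A v u)             ≡⟨ cong (λ a → χS' v * (A w v * a)) (A-sym v u) ⟩
        χS' v * (A w v * A u v)             ≡⟨ cong (χS' v *_) (proj₂ meet v) ⟩
        χS' v * δ v p                       ≤⟨ χ-scale-≤ (inS' v) (χ-nonneg ⌊ v ≟ᶠ p ⌋) ⟩
        δ v p                               ≡⟨ sym (*-identityʳ (δ v p)) ⟩
        δ v p * 1ℤ                          ∎

    -- Double counting through the points of R on θ(w): for non-absolute w ∈ S,
    -- w has no more neighbours in S' than points of R on its polar.
    S'≤R : ∀ w → inS w ≡ true → absolute w ≡ false → x w ≤ t w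
    S'≤R w w∈S w-nabs = begin
      x w
        ≤⟨ sum-mono (R-witness w w∈S w-nabs) ⟩
      ∑[ v < n ] (A w v * χS' v * ∑[ u < n ] commonR w v u)
        ≡⟨ sum-cong-≗ (λ v → *-distribˡ-sum (A w v * χS' v) (commonR w v)) ⟩
      ∑[ v < n ] ∑[ u < n ] (A w v * χS' v * commonR w v u)
        ≡⟨ ∑-comm (λ v u → A w v * χS' v * commonR w v u) ⟩
      ∑[ u < n ] ∑[ v < n ] (A w v * χS' v * commonR w v u)
        ≡⟨ sum-cong-≗ (λ u → trans (sum-cong-≗ (λ v → ring (A w v) (χS' v) (A w u) (χR u) (A v u)))
                                   (sym (*-distribˡ-sum (A w u * χR u) (λ v → A w v * χS' v * A v u)))) ⟩
      ∑[ u < n ] (A w u * χR u * ∑[ v < n ] (A w v * χS' v * A v u))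
        ≤⟨ sum-mono (λ u → at-most-one u) ⟩
      t w ∎
      where
      open ≤-Reasoning
      ring : ∀ a b c d e → a * b * (c * d * e) ≡ c * d * (a * b * e)
      ring = solve-∀
      at-most-one : ∀ u → A w u * χR u * ∑[ v < n ] (A w v * χS' v * A v u) ≤ A w u * χR u
      at-most-one u = begin
        A w u * χR u * ∑[ v < n ] (A w v * χS' v * A v u)
          ≡⟨ cong (_* ∑[ v < n ] (A w v * χS' v * A v u)) (χ-∧ (I u (θp w)) (inR u)) ⟩
        χ (I u (θp w) ∧ inR u) * ∑[ v < n ] (A w v * χS' v * A v u)
          ≤⟨ χ-weight-≤ (I u (θp w) ∧ inR u) (S'-unique w w∈S u) ⟩
        χ (I u (θp w) ∧ inR u)
          ≡⟨ sym (χ-∧ (I u (θp w)) (inR u)) ⟩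
        A w u * χR u ∎

    local-bound : ∀ w → inS w ≡ true → absolute w ≡ false → + 2 * x w + z w ≤ 1ℤ + + q
    local-bound w w∈S w-nabs = begin
      + 2 * x w + z w     ≡⟨ ring (x w) (z w) ⟩
      x w + z w + x w     ≤⟨ +-monoʳ-≤ (x w + z w) (S'≤R w w∈S w-nabs) ⟩
      x w + z w + t w     ≡⟨ polar-split w ⟩
      1ℤ + + q            ∎
      where
      open ≤-Reasoning
      ring : ∀ x z → + 2 * x + z ≡ x + z + x
      ring = solve-∀

    a N : ℤ
    a = sum χS'
    N = sum χX

    f₁ : Point → ℤ
    f₁ v = + 4 * χS' v + χX v

    sum-f₁ : sum f₁ ≡ + 4 * a + N
    sum-f₁ = trans (∑-distrib-+ (λ v → + 4 * χS' v) χX) (cong (_+ N) (sym (*-distribˡ-sum (+ 4) χS')))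

    norm-f₁ : ⟨ f₁ , f₁ ⟩ ≡ + 16 * a + N
    norm-f₁ = trans (sum-cong-≗ square) (trans (∑-distrib-+ (λ v → + 16 * χS' v) χX)
                                              (cong (_+ N) (sym (*-distribˡ-sum (+ 16) χS'))))
      where
      square : ∀ v → f₁ v * f₁ v ≡ + 16 * χS' v + χX v
      square v with inS v | absolute v
      ... | true | true = refl
      ... | true | false = refl
      ... | false | true = refl
      ... | false | false = refl

    act-f₁ : ∀ w → act f₁ w ≡ + 4 * x w + z w
    act-f₁ w = trans (sum-cong-≗ (λ v → ring (A w v) (χS' v) (χX v)))
      (trans (∑-distrib-+ (λ v → + 4 * (A w v * χS' v)) (λ v → A w v * χX v))
             (cong (_+ z w) (sym (*-distribˡ-sum (+ 4) (λ v → A w v * χS' v)))))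
      where
      ring : ∀ a s x → a * (+ 4 * s + x) ≡ + 4 * (a * s) + a * x
      ring = solve-∀

    -- Pointwise this is the local
    -- bound on S' and the tangent count on X, up to the term
    -- 4(1_X·x − 1_S'·z), whose sum vanishes because A is self-adjoint.
    energy-f₁ : ⟨ f₁ , act f₁ ⟩ ≤ + 8 * (1ℤ + + q) * a + N
    energy-f₁ = begin
      ⟨ f₁ , act f₁ ⟩
        ≤⟨ sum-mono pointwise ⟩
      ∑[ w < n ] (+ 8 * (1ℤ + + q) * χS' w + + 4 * cross w + 1ℤ * χX w)
        ≡⟨ sum-lin3 (+ 8 * (1ℤ + + q)) (+ 4) 1ℤ χS' cross χX ⟩
      + 8 * (1ℤ + + q) * a + + 4 * sum cross + 1ℤ * N
        ≡⟨ cong (λ c → + 8 * (1ℤ + + q) * a + + 4 * c + 1ℤ * N) cross-vanishes ⟩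
      + 8 * (1ℤ + + q) * a + + 4 * 0ℤ + 1ℤ * N
        ≡⟨ ring (+ 8 * (1ℤ + + q) * a) N ⟩
      + 8 * (1ℤ + + q) * a + N ∎
      where
      open ≤-Reasoning
      cross : Point → ℤ
      cross w = χX w * x w - χS' w * z w
      cross-vanishes : sum cross ≡ 0ℤ
      cross-vanishes = begin-equality
        sum cross                           ≡⟨ sum-cong-≗ (λ w → ring₁ (χX w * x w) (χS' w * z w)) ⟩
        ∑[ w < n ] (1ℤ * (χX w * x w) + - 1ℤ * (χS' w * z w))
                                            ≡⟨ sum-lin 1ℤ (- 1ℤ) (λ w → χX w * x w) (λ w → χS' w * z w) ⟩
        1ℤ * ⟨ χX , x ⟩ + - 1ℤ * ⟨ χS' , z ⟩ ≡⟨ cong (λ c → 1ℤ * c + - 1ℤ * ⟨ χS' , z ⟩) (act-selfadjoint χX χS') ⟩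
        1ℤ * ⟨ χS' , z ⟩ + - 1ℤ * ⟨ χS' , z ⟩ ≡⟨ ring₂ ⟨ χS' , z ⟩ ⟩
        0ℤ                                  ∎
        where
        ring₁ : ∀ a b → a - b ≡ 1ℤ * a + - 1ℤ * b
        ring₁ = solve-∀
        ring₂ : ∀ c → 1ℤ * c + - 1ℤ * c ≡ 0ℤ
        ring₂ = solve-∀
      ring : ∀ b N → b + + 4 * 0ℤ + 1ℤ * N ≡ b + N
      ring = solve-∀
      absolute-case : ∀ q x → (+ 4 * 0ℤ + 1ℤ) * (+ 4 * x + 1ℤ) ≡
        + 8 * (1ℤ + q) * 0ℤ + + 4 * (1ℤ * x - 0ℤ * 1ℤ) + 1ℤ * 1ℤ
      absolute-case = solve-∀
      pointwise : ∀ w → f₁ w * act f₁ w ≤ + 8 * (1ℤ + + q) * χS' w + + 4 * cross w + 1ℤ * χX w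
      pointwise w rewrite act-f₁ w with inS w in w∈S | absolute w in w-abs
      ... | true | false = 0≤i-j⇒j≤i (≤-trans (mul-nonneg {+ 8} (+≤+ ℕ.z≤n) (i≤j⇒0≤j-i (local-bound w w∈S w-abs)))
                                            (≤-reflexive (S'-case (+ q) (x w) (z w))))
        where
        S'-case : ∀ q x z → + 8 * ((1ℤ + q) - (+ 2 * x + z)) ≡
          + 8 * (1ℤ + q) * 1ℤ + + 4 * (0ℤ * x - 1ℤ * z) + 1ℤ * 0ℤ - (+ 4 * 1ℤ + 0ℤ) * (+ 4 * x + z)
        S'-case = solve-∀
      ... | true | true rewrite tangent-count w w-abs = ≤-reflexive (absolute-case (+ q) (x w))
      ... | false | true rewrite tangent-count w w-abs = ≤-reflexive (absolute-case (+ q) (x w))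
      ... | false | false = ≤-reflexive (other-case (+ q) (x w) (z w))
        where
        other-case : ∀ q x z → (+ 4 * 0ℤ + 0ℤ) * (+ 4 * x + z) ≡ + 8 * (1ℤ + q) * 0ℤ + + 4 * (0ℤ * x - 0ℤ * z) + 1ℤ * 0ℤ
        other-case = solve-∀

    norm-X : ⟨ χX , χX ⟩ ≡ N
    norm-X = sum-cong-≗ (λ v → χ-idem (absolute v))

    energy-X : ⟨ χX , act χX ⟩ ≡ N
    energy-X = sum-cong-≗ tangent-term
      where
      tangent-term : ∀ w → χX w * z w ≡ χX w
      tangent-term w with absolute w in w-abs
      ... | true = trans (*-identityˡ (z w)) (tangent-count w w-abs)
      ... | false = refl

    -- S ⊆ S' ∪ X
    card-S : + ∣ S ∣ ≤ a + N
    card-S = ≤-trans (≤-reflexive (card-sum S)) (≤-trans (sum-mono cover) (≤-reflexive (∑-distrib-+ χS' χX)))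
      where
      cover : ∀ v → χ (lookup S v) ≤ χS' v + χX v
      cover v with inS v | absolute v
      ... | true | true = +≤+ (ℕ.s≤s ℕ.z≤n)
      ... | true | false = ≤-refl
      ... | false | true = +≤+ ℕ.z≤n
      ... | false | false = ≤-refl

    excess-bound : let T = (1ℤ + + q) * (+ 2 * + ∣ S ∣ - + n) in
      0ℤ < T → + 4 * + q * (+ n * + n) ≤ T * T → ⊥
    excess-bound T>0 T²≥4qn² = excess-contradiction (+ q) (+ n) a N (+≤+ order≥2) n>0 N≥0 d'>0 T'²≥4qn²
      (SpectralIneq-mono {+ q} {+ n} {T'} {+ 4 * a + N} {+ 16 * a + N} (<⇒≤ n>0) energy-f₁
        (subst₂ (λ s Q → SpectralIneq (+ q) (+ n) T' s Q ⟨ f₁ , act f₁ ⟩) sum-f₁ norm-f₁ (spectral f₁)))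
      (subst₂ (λ Q P → SpectralIneq (+ q) (+ n) T' N Q P) norm-X energy-X (spectral χX))
      where
      T d d' T' : ℤ
      d = + 2 * + ∣ S ∣ - + n
      T = (1ℤ + + q) * d
      -- the excess computed with |S'| + |X| ≥ |S| in place of |S|
      d' = + 2 * (a + N) - + n
      T' = (1ℤ + + q) * d'
      n>0 : 0ℤ < + n
      n>0 = +<+ (ℕP.m≤n+m 1 (q ℕ.* q ℕ.+ q))
      N≥0 : 0ℤ ≤ N
      N≥0 = sum-nonneg (λ v → χ-nonneg (absolute v))
      q+1≥0 : 0ℤ ≤ 1ℤ + + q
      q+1≥0 = +≤+ ℕ.z≤n
      d≤d' : d ≤ d'
      d≤d' = +-monoˡ-≤ (- + n) (*-monoˡ-≤-nonNeg (+ 2) card-S)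
      T'>0 : 0ℤ < T'
      T'>0 = <-≤-trans T>0 (*-monoˡ-≤-nonNeg (1ℤ + + q) d≤d')
      d'>0 : 0ℤ < d'
      d'>0 = pos-factorʳ q+1≥0 T'>0
      T'²≥4qn² : + 4 * + q * (+ n * + n) ≤ T' * T'
      T'²≥4qn² = ≤-trans T²≥4qn² (sq-mono (<⇒≤ T>0) (*-monoˡ-≤-nonNeg (1ℤ + + q) d≤d'))
      spectral : ∀ f → SpectralIneq (+ q) (+ n) T' (sum f) ⟨ f , f ⟩ ⟨ f , act f ⟩
      spectral f = spectral-bound f T' n>0 T'>0 T'²≥4qn²

    excess-bound-ℕ : ∀ x → 2 ℕ.* (q ℕ.+ 1) ℕ.* ∣ S ∣ ℕ.∸ (q ℕ.+ 1) ℕ.* n ≡ suc x →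
      suc x ℕ.^ 2 ℕ.≤ 4 ℕ.* q ℕ.* (n ℕ.^ 2)
    excess-bound-ℕ x excess = ℕP.≮⇒≥ λ bound<x² → excess-bound T>0 (begin
      + 4 * + q * (+ n * + n)             ≡⟨ cong₂ _*_ (sym (pos-* 4 q)) (sym (pos-square n)) ⟩
      + (4 ℕ.* q) * + (n ℕ.^ 2)           ≡⟨ sym (pos-* (4 ℕ.* q) (n ℕ.^ 2)) ⟩
      + (4 ℕ.* q ℕ.* (n ℕ.^ 2))           ≤⟨ +≤+ (ℕP.<⇒≤ bound<x²) ⟩
      + (suc x ℕ.^ 2)                     ≡⟨ pos-square (suc x) ⟩
      + suc x * + suc x                   ≡⟨ cong₂ _*_ excess-ℤ excess-ℤ ⟩
      (1ℤ + + q) * d * ((1ℤ + + q) * d)   ∎)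
      where
      open ≤-Reasoning
      d : ℤ
      d = + 2 * + ∣ S ∣ - + n
      pos-square : ∀ m → + (m ℕ.^ 2) ≡ + m * + m
      pos-square m = trans (pos-* m (m ℕ.* 1)) (cong (λ r → + m * + r) (ℕP.*-identityʳ m))
      below : (q ℕ.+ 1) ℕ.* n ℕ.< 2 ℕ.* (q ℕ.+ 1) ℕ.* ∣ S ∣
      below = ℕP.m∸n≢0⇒n<m (λ eq → ℕP.0≢1+n (trans (sym eq) excess))
      ring : ∀ q s n → + 2 * (q + 1ℤ) * s - (q + 1ℤ) * n ≡ (1ℤ + q) * (+ 2 * s - n)
      ring = solve-∀
      excess-ℤ : + suc x ≡ (1ℤ + + q) * d
      excess-ℤ = begin-equality
        + suc x
          ≡⟨ cong +_ (sym excess) ⟩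
        + (2 ℕ.* (q ℕ.+ 1) ℕ.* ∣ S ∣ ℕ.∸ (q ℕ.+ 1) ℕ.* n)
          ≡⟨ sym (trans (m-n≡m⊖n (2 ℕ.* (q ℕ.+ 1) ℕ.* ∣ S ∣) ((q ℕ.+ 1) ℕ.* n)) (⊖-≥ (ℕP.<⇒≤ below))) ⟩
        + (2 ℕ.* (q ℕ.+ 1) ℕ.* ∣ S ∣) - + ((q ℕ.+ 1) ℕ.* n)
          ≡⟨ cong₂ _-_ (trans (pos-* (2 ℕ.* (q ℕ.+ 1)) ∣ S ∣) (cong (_* + ∣ S ∣) (trans (pos-* 2 (q ℕ.+ 1)) (cong (+ 2 *_) (pos-+ q 1)))))
                       (trans (pos-* (q ℕ.+ 1) n) (cong (_* + n) (pos-+ q 1))) ⟩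
        + 2 * (+ q + 1ℤ) * + ∣ S ∣ - (+ q + 1ℤ) * + n
          ≡⟨ ring (+ q) (+ ∣ S ∣) (+ n) ⟩
        (1ℤ + + q) * d ∎
      T>0 : 0ℤ < (1ℤ + + q) * d
      T>0 = subst (0ℤ <_) excess-ℤ (+<+ (ℕ.s≤s ℕ.z≤n))

open import Data.Nat using (_+_; _*_; _∸_; _^_; _≤_; z≤n)

theorem1p2 : (q : ℕ) (Π : ProjectivePlane q) (θ : Polarity Π)
    (S : Subset (numPts q)) → TriangleFree θ S →
    (2 * (q + 1) * ∣ S ∣ ∸ (q + 1) * numPts q) ^ 2 ≤ 4 * q * (numPts q ^ 2)
theorem1p2 q Π θ S triangle-free with 2 * (q + 1) * ∣ S ∣ ∸ (q + 1) * numPts q in excess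
... | zero = z≤n
... | suc x = TriangleFreeSet.excess-bound-ℕ Π θ S triangle-free x excess
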